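{- Let $\gamma:Z\rightharpoonup\wp(W)$ be a relation and let $f:Y\rightharpoonup\wp(Z)$ and $h:Y\rightharpoonup\wp(W)$ be partial functions. If $\gamma$ is union-closed, $h\sqsubseteq f\gamma_*$ and $\mathrm{dom}\,h=\mathrm{dom}\,f$, then $h_*\sqsubseteq f_*\gamma_*$.
   Context: Relations $\alpha:X\rightharpoonup Y$ are subsets of $X\times Y$ (sets with the axiom of choice); juxtaposition is relational composition; $\sqsubseteq$ inclusion, $\sqcup$ union; $\mathrm{dom}\,\alpha=\{(x,x)\mid\exists y.\,(x,y)\in\alpha\}$; a pfn (partial function) is a univalent relation. $\ni_W:\wp(W)\rightharpoonup W$ is membership. For $\rho:Z\rightharpoonup W$, $\rho^@:Z\to\wp(W)$ is $z\mapsto\{w\mid(z,w)\in\rho\}$. For $f:Y\rightharpoonup\wp(Z)$, $(B,A)\in f_\circ$ iff $A=\bigcup\{C\mid\exists b\in B.\,(b,C)\in f\}$. For $v\sqsubseteq\mathrm{id}_Y$, $\hat u_v=\{(A,A)\mid A\subseteq Y,\ \forall a\in A.\,(a,a)\in v\}$. $f\sqsubseteq_c\beta$ means $f\sqsubseteq\beta$, $f$ a pfn, $\mathrm{dom}\,f=\mathrm{dom}\,\beta$. Peleg lifting: $\beta_*=\bigsqcup_{f\sqsubseteq_c\beta}\hat u_{\mathrm{dom}\,\beta}f_\circ$. A relation $\gamma:Z\rightharpoonup\wp(W)$ is union-closed if $\mathrm{dom}\,\rho\,(\rho\ni_W)^@\sqsubseteq\gamma$ for all $\rho\sqsubseteq\gamma$;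 equivalently, for each $a\in Z$, every nonempty family $\mathcal B\subseteq\{B\mid(a,B)\in\gamma\}$ satisfies $(a,\bigcup\mathcal B)\in\gamma$. -}

module Defs where

-- Relations X ⇀ Y are modelled as stdlib heterogeneous relations
-- REL X Y ℓ (= X → Y → Set ℓ); composition is stdlib _;_ , inclusion ⊑ is
-- stdlib _⇒_ .  Subsets of a set X are predicates ℘ X = Pred X 0ℓ, and
-- equality of subsets is extensional equality _≐_ (mutual inclusion).

open import Level using (Level; 0ℓ; _⊔_)
open import Data.Product using (Σ; ∃; _×_; _,_)
open import Relation.Binary.PropositionalEquality using (_≡_)
open import Relation.Unary using (Pred; _≐_)
open import Relation.Binary.Core using (REL; _⇒_)

private
  variable
    a b c ℓ ℓ₁ : Level

infixr 9 _⨾_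
_⨾_ : {A : Set a} {B : Set b} {C : Set c} → REL A B ℓ → REL B C ℓ₁ → REL A C (b ⊔ ℓ ⊔ ℓ₁)
(α ⨾ β) x z = ∃ λ y → α x y × β y z

℘ : Set → Set₁
℘ X = Pred X 0ℓ

_≡ᴿ_ : {X : Set a} {Y : Set b} → REL X Y ℓ → REL X Y ℓ₁ → Set _
α ≡ᴿ β = (α ⇒ β) × (β ⇒ α)

dom : {X : Set a} {Y : Set b} → REL X Y ℓ → REL X X (a ⊔ b ⊔ ℓ)
dom α x x′ = (x ≡ x′) × ∃ (α x)

∋ : {W : Set} → REL (℘ W) W 0ℓ
∋ B w = B w

_^ᵃ : {Z W : Set} → REL Z W ℓ → REL Z (℘ W) ℓ
(ρ ^ᵃ) z A = A ≐ ρ z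

-- partial function (univalent relation); codomain a power set, whose
-- equality is extensional
PFn : {X W : Set} → REL X (℘ W) ℓ → Set _
PFn f = ∀ {x B B′} → f x B → f x B′ → B ≐ B′

_∘ᵘ : {Y Z : Set} → REL Y (℘ Z) ℓ → REL (℘ Y) (℘ Z) (Level.suc 0ℓ ⊔ ℓ)
(f ∘ᵘ) B A = A ≐ (λ z → ∃ λ (C : ℘ _) → (∃ λ b → B b × f b C) × C z)

û : {Y : Set} → REL Y Y ℓ → REL (℘ Y) (℘ Y) ℓ
û v A A′ = (A ≐ A′) × (∀ a → A a → v a a)

_⊑c_ : {Y Z : Set} → REL Y (℘ Z) ℓ → REL Y (℘ Z) ℓ₁ → Set _
f ⊑c β = (f ⇒ β) × PFn f × (dom f ≡ᴿ dom β)

-- Peleg lifting  β_* = ⊔_{f ⊑_c β} û_{dom β} f∘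
-- (choice functions f range over subrelations at the level of β)
_* : {Y Z : Set} → REL Y (℘ Z) ℓ → REL (℘ Y) (℘ Z) (Level.suc ℓ)
(_* {ℓ = ℓ} {Y = Y} {Z = Z} β) A C =
  ∃ λ (f : REL Y (℘ Z) ℓ) → (f ⊑c β) × (û (dom β) ⨾ (f ∘ᵘ)) A C

UnionClosed : {Z W : Set} → REL Z (℘ W) 0ℓ → Set₁
UnionClosed {Z} {W} γ =
  ∀ (ρ : REL Z (℘ W) 0ℓ) → ρ ⇒ γ → (dom ρ ⨾ ((ρ ⨾ ∋) ^ᵃ)) ⇒ γ

-- A decomposition h_* A C of the lifted pfn h says C = ⋃_{a ∈ A} h(a), and for
-- each a there are f(a) = D_a and a choice function g_a ⊑c γ with
-- h(a) = ⋃_{z ∈ D_a} g_a(z).  Take B = ⋃_{a ∈ A} f(a); then f_* A B.  The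
-- various g_a need not agree on B, but union-closedness lets us glue them: the
-- single choice function g(z) = ⋃ {g_a(z) | a ∈ A, z ∈ D_a} still lies in γ,
-- and ⋃_{z ∈ B} g(z) = C, so γ_* B C.  Excluded middle is used to resize
-- large predicates (ranging over ℘ W) back into Set, and to extend g outside B.
module Submission where

open import Defs
open import Level using (Level; 0ℓ; suc; _⊔_; Lift; lift; lower)
open import Relation.Binary.Core using (REL; _⇒_)
open import Axiom.ExcludedMiddle using (ExcludedMiddle)
open import Data.Product using (∃; _×_; _,_; proj₁; proj₂)
open import Data.Sum using (_⊎_; inj₁; inj₂)
open import Data.Empty using (⊥-elim)
open import Function using (id)
open import Relation.Nullary using (Dec; yes; no; ¬_)
open import Relation.Nullary.Decidable using (True; toWitness; fromWitness; map′)
open import Relation.Unary using (Pred; _⊆_; _≐_)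
open import Relation.Unary.Properties using (≐-refl; ≐-sym; ≐-trans)
open import Relation.Binary.PropositionalEquality using (refl)

private
  variable
    ℓ ℓ₁ : Level
    Y Z W : Set

-- (f ∘ᵘ) B C unfolds to C ≐ ⋃⟨ f ⟩ B.
⋃⟨_⟩ : REL Y (℘ Z) ℓ → ℘ Y → Pred Z (suc 0ℓ ⊔ ℓ)
⋃⟨ f ⟩ B z = ∃ λ C → (∃ λ b → B b × f b C) × C z

⋃⟨⟩-cong : (f : REL Y (℘ Z) ℓ) {A A′ : ℘ Y} → A ≐ A′ → ⋃⟨ f ⟩ A ≐ ⋃⟨ f ⟩ A′
⋃⟨⟩-cong f (A⊆A′ , A′⊆A) =
  (λ (C , (b , Ab , fbC) , Cz) → C , (b , A⊆A′ Ab , fbC) , Cz) ,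
  (λ (C , (b , A′b , fbC) , Cz) → C , (b , A′⊆A A′b , fbC) , Cz)

⊑c-defined : {g : REL Y (℘ Z) ℓ} {β : REL Y (℘ Z) ℓ₁} {y : Y} →
             g ⊑c β → dom β y y → ∃ (g y)
⊑c-defined (_ , _ , _ , dom-β⇒dom-g) y∈dom = proj₂ (dom-β⇒dom-g y∈dom)

⋃⟨⟩-⊑c : {h : REL Y (℘ Z) ℓ} {k : REL Y (℘ Z) ℓ₁} → PFn h → k ⊑c h →
         (A : ℘ Y) → ⋃⟨ k ⟩ A ≐ ⋃⟨ h ⟩ A
⋃⟨⟩-⊑c h-pfn k⊑ch@(k⇒h , _) A =
  (λ (K , (a , Aa , kaK) , Kz) → K , (a , Aa , k⇒h kaK) , Kz) ,
  λ (H , (a , Aa , haH) , Hz) →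
    let K , kaK = ⊑c-defined k⊑ch (refl , H , haH)
    in K , (a , Aa , kaK) , proj₂ (h-pfn (k⇒h kaK) haH) Hz

⊑c-refl : {f : REL Y (℘ Z) ℓ} → PFn f → f ⊑c f
⊑c-refl f-pfn = id , f-pfn , id , id

*-intro : {β : REL Y (℘ Z) ℓ} {g : REL Y (℘ Z) ℓ} {A : ℘ Y} {C : ℘ Z} →
          g ⊑c β → (∀ a → A a → dom β a a) → C ≐ ⋃⟨ g ⟩ A → (β *) A C
*-intro g⊑cβ A⊆dom C≐ = _ , g⊑cβ , _ , (≐-refl , A⊆dom) , C≐

*-elim : {β : REL Y (℘ Z) ℓ} {A : ℘ Y} {C : ℘ Z} → (β *) A C →
         ∃ λ g → g ⊑c β × (∀ a → A a → dom β a a) × C ≐ ⋃⟨ g ⟩ A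
*-elim (g , g⊑cβ , A′ , (A≐A′ , A⊆dom) , C≐) =
  g , g⊑cβ , A⊆dom , ≐-trans C≐ (⋃⟨⟩-cong g (≐-sym A≐A′))

*-PFn-elim : {h : REL Y (℘ Z) ℓ} {A : ℘ Y} {C : ℘ Z} → PFn h → (h *) A C →
             (∀ a → A a → dom h a a) × C ≐ ⋃⟨ h ⟩ A
*-PFn-elim {A = A} h-pfn h*AC =
  let k , k⊑ch , A⊆dom , C≐ = *-elim h*AC
  in A⊆dom , ≐-trans C≐ (⋃⟨⟩-⊑c h-pfn k⊑ch A)

module _ (em : ExcludedMiddle (suc (suc 0ℓ))) where

  dec₁ : (P : Set₁) → Dec P
  dec₁ P = map′ lower lift (em {Lift _ P})

  ⌊_⌋ : Set₁ → Set
  ⌊ P ⌋ = True (dec₁ P)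

  resize : {X : Set} → Pred X (suc 0ℓ) → ℘ X
  resize P x = ⌊ P x ⌋

  resize-≐ : {X : Set} (P : Pred X (suc 0ℓ)) → resize P ≐ P
  resize-≐ P = toWitness , fromWitness

  -- Outside the domain of P the glued function takes ⋃ γ(z), again in γ.
  unionClosed-choice : {γ : REL Z (℘ W) 0ℓ} → UnionClosed γ →
    (P : REL Z (℘ W) (suc 0ℓ)) → P ⇒ γ →
    ∃ λ g → g ⊑c γ × (∀ {z E} → ∃ (P z) → g z E → E ≐ (P ⨾ ∋) z)
  unionClosed-choice {Z = Z} {W = W} {γ = γ} uc P P⇒γ =
    g , (g⇒γ , g-pfn , (λ (eq , E , gzE) → eq , E , g⇒γ gzE) , dom-γ⇒dom-g) , g-spec
    where
    ρ : REL Z (℘ W) 0ℓ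
    ρ z F = ⌊ P z F ⊎ (¬ ∃ (P z) × γ z F) ⌋

    g : REL Z (℘ W) 0ℓ
    g z E = ⌊ ∃ (γ z) × E ≐ (ρ ⨾ ∋) z ⌋

    ρ⇒γ : ρ ⇒ γ
    ρ⇒γ ρzF with toWitness ρzF
    ... | inj₁ PzF       = P⇒γ PzF
    ... | inj₂ (_ , γzF) = γzF

    ρ-nonempty : ∀ {z} → ∃ (γ z) → ∃ (ρ z)
    ρ-nonempty {z} (E , γzE) with dec₁ (∃ (P z))
    ... | yes (F , PzF) = F , fromWitness (inj₁ PzF)
    ... | no ¬Pz        = E , fromWitness (inj₂ (¬Pz , γzE))

    g⇒γ : g ⇒ γ
    g⇒γ {z} gzE =
      let γz , E≐ = toWitness gzE
      in uc ρ ρ⇒γ (z , (refl , ρ-nonempty γz) , E≐)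

    g-pfn : PFn g
    g-pfn gzE gzE′ = ≐-trans (proj₂ (toWitness gzE)) (≐-sym (proj₂ (toWitness gzE′)))

    dom-γ⇒dom-g : dom γ ⇒ dom g
    dom-γ⇒dom-g {z} (eq , γz) =
      eq , resize ((ρ ⨾ ∋) z) , fromWitness (γz , resize-≐ ((ρ ⨾ ∋) z))

    ρ≐P : ∀ {z} → ∃ (P z) → (ρ ⨾ ∋) z ≐ (P ⨾ ∋) z
    ρ≐P {z} Pz =
      (λ (F , ρzF , Fw) → case-ρ (toWitness ρzF) Fw) ,
      (λ (F , PzF , Fw) → F , fromWitness (inj₁ PzF) , Fw)
      where
      case-ρ : ∀ {F w} → P z F ⊎ (¬ ∃ (P z) × γ z F) → F w → (P ⨾ ∋) z w
      case-ρ (inj₁ PzF) Fw       = _ , PzF , Fw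
      case-ρ (inj₂ (¬Pz , _)) _  = ⊥-elim (¬Pz Pz)

    g-spec : ∀ {z E} → ∃ (P z) → g z E → E ≐ (P ⨾ ∋) z
    g-spec Pz gzE = ≐-trans (proj₂ (toWitness gzE)) (ρ≐P Pz)

module _ (em : ExcludedMiddle (suc (suc 0ℓ)))
  {γ : REL Z (℘ W) 0ℓ} {f : REL Y (℘ Z) 0ℓ} {h : REL Y (℘ W) 0ℓ}
  (uc : UnionClosed γ) (f-pfn : PFn f) (h⊑fγ* : h ⇒ (f ⨾ (γ *)))
  {A : ℘ Y} (A⊆dom-h : ∀ a → A a → dom h a a) where

  Contribution : REL Z (℘ W) (suc 0ℓ)
  Contribution z F = ∃ λ a → A a × ∃ λ H → h a H × ∃ λ D → f a D × D z ×
    ∃ λ g → g ⊑c γ × H ≐ ⋃⟨ g ⟩ D × g z F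

  Contribution⇒γ : Contribution ⇒ γ
  Contribution⇒γ (_ , _ , _ , _ , _ , _ , _ , _ , (g⇒γ , _) , _ , gzF) = g⇒γ gzF

  contribution-exists : ∀ {z} → ⋃⟨ f ⟩ A z → ∃ (Contribution z)
  contribution-exists (D , (a , Aa , faD) , Dz)
    with _ , H , haH ← A⊆dom-h a Aa
    with D′ , faD′ , γ*D′H ← h⊑fγ* haH
    with g , g⊑cγ , D′⊆dom-γ , H≐ ← *-elim γ*D′H =
    let D′z = proj₁ (f-pfn faD faD′) Dz
        F , gzF = ⊑c-defined g⊑cγ (D′⊆dom-γ _ D′z)
    in F , a , Aa , H , haH , D′ , faD′ , D′z , g , g⊑cγ , H≐ , gzF

  B : ℘ Z
  B = resize em (⋃⟨ f ⟩ A)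

  B⊆dom-γ : ∀ z → B z → dom γ z z
  B⊆dom-γ z Bz = let F , c = contribution-exists (toWitness Bz) in refl , F , Contribution⇒γ c

  glued-image : {g : REL Z (℘ W) 0ℓ} → g ⊑c γ →
                (∀ {z E} → ∃ (Contribution z) → g z E → E ≐ (Contribution ⨾ ∋) z) →
                ⋃⟨ h ⟩ A ≐ ⋃⟨ g ⟩ B
  glued-image {g} g⊑cγ g-spec = ⋃h⊆⋃g , ⋃g⊆⋃h
    where
    ⋃h⊆⋃g : ⋃⟨ h ⟩ A ⊆ ⋃⟨ g ⟩ B
    ⋃h⊆⋃g (H , (a , Aa , haH) , Hw)
      with D , faD , γ*DH ← h⊑fγ* haH
      with g′ , g′⊑cγ , _ , H≐ ← *-elim γ*DH
      with F , (z , Dz , g′zF) , Fw ← proj₁ H≐ Hw =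
      let c : Contribution z F
          c = a , Aa , H , haH , D , faD , Dz , g′ , g′⊑cγ , H≐ , g′zF
          E , gzE = ⊑c-defined g⊑cγ (refl , F , Contribution⇒γ c)
      in E , (z , fromWitness (D , (a , Aa , faD) , Dz) , gzE) , proj₂ (g-spec (F , c) gzE) (F , c , Fw)

    ⋃g⊆⋃h : ⋃⟨ g ⟩ B ⊆ ⋃⟨ h ⟩ A
    ⋃g⊆⋃h (E , (z , Bz , gzE) , Ew)
      with F , (a , Aa , H , haH , D , _ , Dz , g′ , _ , H≐ , g′zF) , Fw
             ← proj₁ (g-spec (contribution-exists (toWitness Bz)) gzE) Ew =
      H , (a , Aa , haH) , proj₂ H≐ (F , (z , Dz , g′zF) , Fw)

  lifting-factorises : {C : ℘ W} → (∀ a → A a → dom f a a) → C ≐ ⋃⟨ h ⟩ A →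
                       ((f *) ⨾ (γ *)) A C
  lifting-factorises A⊆dom-f C≐ =
    let g , g⊑cγ , g-spec = unionClosed-choice em uc Contribution Contribution⇒γ
    in B , *-intro (⊑c-refl f-pfn) A⊆dom-f (resize-≐ em _) ,
       *-intro g⊑cγ B⊆dom-γ (≐-trans C≐ (glued-image g⊑cγ g-spec))

proposition8p2 : ExcludedMiddle (suc (suc 0ℓ)) →
    {Y Z W : Set} (γ : REL Z (℘ W) 0ℓ) (f : REL Y (℘ Z) 0ℓ) (h : REL Y (℘ W) 0ℓ) →
    PFn f → PFn h → UnionClosed γ → h ⇒ (f ⨾ (γ *)) → dom h ≡ᴿ dom f →
    (h *) ⇒ ((f *) ⨾ (γ *))
proposition8p2 em γ f h f-pfn h-pfn uc h⊑fγ* (dom-h⇒dom-f , _) h*AC =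
  let A⊆dom-h , C≐⋃h = *-PFn-elim h-pfn h*AC
  in lifting-factorises em uc f-pfn h⊑fγ* A⊆dom-h
       (λ a Aa → dom-h⇒dom-f (A⊆dom-h a Aa)) C≐⋃h
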